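{- Let $C'(\Gamma_n,x)=\sum_{p\geq 0} f_{n,p}x^p$, where $f_{n,p}$ is the number of maximal hypercubes of dimension $p$ in the Fibonacci cube $\Gamma_n$. Then \[C'(\Gamma_n,x)=x\bigl(C'(\Gamma_{n-2},x)+C'(\Gamma_{n-3},x)\bigr)\quad (n\geq 3),\] with $C'(\Gamma_0,x)=1$, $C'(\Gamma_1,x)=x$, $C'(\Gamma_2,x)=2x$, and the generating function is \[\sum_{n\geq0}C'(\Gamma_n,x)y^n=\frac{1+xy(1+y)}{1-xy^2(1+y)}.\]
   Context: $Q_n$ is the $n$-dimensional hypercube: vertices are binary strings of length $n$, adjacent iff they differ in exactly one coordinate. A Fibonacci string of length $n$ is a binary string $b_1\dots b_n$ with $b_ib_{i+1}=0$ for $1\le i<n$; the Fibonacci cube $\Gamma_n$ ($n\ge1$) is the subgraph of $Q_n$ induced by the Fibonacci strings of length $n$, and $\Gamma_0=K_1$. A hypercube of dimension $p$ in $\Gamma_n$ is an induced subgraph isomorphic to $Q_p$; it is maximal if it is not contained in any induced subgraph of $\Gamma_n$ isomorphic to $Q_{p+1}$. -}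

module Defs where

open import Data.Nat using (ℕ; zero; suc; _+_; _∸_)
open import Data.Bool using (Bool; true; false; _∧_)
open import Data.Vec using (Vec; []; _∷_; lookup)
open import Data.Fin using (Fin)
open import Data.Product using (Σ; ∃; ∃-syntax; _×_; _,_)
open import Data.Integer as ℤ using (ℤ; +_)
open import Relation.Binary.PropositionalEquality using (_≡_)
open import Relation.Nullary using (¬_)

dist : ∀ {n} → Vec Bool n → Vec Bool n → ℕ
dist [] [] = 0
dist (a ∷ u) (b ∷ v) with a Data.Bool.≟ b
... | Relation.Nullary.yes _ = dist u v
... | Relation.Nullary.no _ = suc (dist u v)

Adj : ∀ {n} → Vec Bool n → Vec Bool n → Set
Adj u v = dist u v ≡ 1

noTwoOnes : ∀ {n} → Vec Bool n → Bool
noTwoOnes [] = true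
noTwoOnes (_ ∷ []) = true
noTwoOnes (true ∷ true ∷ _) = false
noTwoOnes (_ ∷ b ∷ v) = noTwoOnes (b ∷ v)

Fib : ∀ {n} → Vec Bool n → Set
Fib v = noTwoOnes v ≡ true

-- Subsets of {0,1}^n, represented canonically as complete binary
-- decision trees of depth n (so two subsets are equal iff they have
-- the same elements).

data Subset : ℕ → Set where
  leaf : Bool → Subset 0
  node : ∀ {n} → Subset n → Subset n → Subset (suc n)

member : ∀ {n} → Subset n → Vec Bool n → Bool
member (leaf b) [] = b
member (node l r) (false ∷ v) = member l v
member (node l r) (true ∷ v) = member r v

_∈S_ : ∀ {n} → Vec Bool n → Subset n → Set
v ∈S S = member S v ≡ true

_⊆S_ : ∀ {n} → Subset n → Subset n → Set
S ⊆S T = ∀ v → v ∈S S → v ∈S T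

-- A vertex set S of Γ_n (S ⊆ Fibonacci strings) whose induced subgraph
-- (induced in Γ_n, i.e. in Q_n) is isomorphic to Q_p: there is a
-- bijection φ : V(Q_p) → S with  u ~ w in Q_p  ⇔  φ u ~ φ w.

IsHypercube : (n p : ℕ) → Subset n → Set
IsHypercube n p S =
  (∀ v → v ∈S S → Fib v) ×
  Σ (Vec Bool p → Vec Bool n) λ φ →
    (∀ u → φ u ∈S S) ×
    (∀ v → v ∈S S → ∃[ u ] φ u ≡ v) ×
    (∀ u w → φ u ≡ φ w → u ≡ w) ×
    (∀ u w → (Adj u w → Adj (φ u) (φ w)) × (Adj (φ u) (φ w) → Adj u w))

IsMaximalHypercube : (n p : ℕ) → Subset n → Set
IsMaximalHypercube n p S =
  IsHypercube n p S × ¬ (Σ (Subset n) λ T → (S ⊆S T) × IsHypercube n (suc p) T)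

HasCount : ∀ {n} → (Subset n → Set) → ℕ → Set
HasCount {n} P k =
  Σ (Vec (Subset n) k) λ xs →
    (∀ i j → lookup xs i ≡ lookup xs j → i ≡ j) ×
    (∀ S → (P S → ∃[ i ] lookup xs i ≡ S) × ((∃[ i ] lookup xs i ≡ S) → P S))

-- Polynomials in x with ℕ coefficients, as coefficient sequences
-- (coefficient of x^p at index p); equality is coefficientwise.

Poly : Set
Poly = ℕ → ℕ

_≈P_ : Poly → Poly → Set
A ≈P B = ∀ p → A p ≡ B p

_+P_ : Poly → Poly → Poly
(A +P B) p = A p + B p

x·_ : Poly → Poly
(x· A) zero = 0
(x· A) (suc p) = A p

constP : ℕ → Poly
constP c zero = c
constP c (suc p) = 0

linP : ℕ → Poly
linP c 1 = c
linP c _ = 0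

-- Formal power series in x, y with ℤ coefficients:
-- F n p = coefficient of x^p y^n.

Series : Set
Series = ℕ → ℕ → ℤ

sumTo : ℕ → (ℕ → ℤ) → ℤ
sumTo zero f = f 0
sumTo (suc n) f = sumTo n f ℤ.+ f (suc n)

_*S_ : Series → Series → Series
(A *S B) n p = sumTo n λ i → sumTo p λ j → A i j ℤ.* B (n ∸ i) (p ∸ j)

_≈S_ : Series → Series → Set
A ≈S B = ∀ n p → A n p ≡ B n p

-- denominator 1 - x y^2 (1 + y) = 1 - x y^2 - x y^3
denom : Series
denom 0 0 = + 1
denom 2 1 = ℤ.- (+ 1)
denom 3 1 = ℤ.- (+ 1)
denom _ _ = + 0

-- numerator 1 + x y (1 + y) = 1 + x y + x y^2
numer : Series
numer 0 0 = + 1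
numer 1 1 = + 1
numer 2 1 = + 1
numer _ _ = + 0

genFun : (ℕ → Poly) → Series
genFun C n p = + (C n p)

-- An induced copy of Q_p in Q_n is a subcube: a set obtained by fixing n − p coordinates
-- and letting the other p range freely.  By induction on p, the two halves of Q_p are
-- subcubes that are disjoint and joined by a perfect matching of edges, which forces them
-- to be opposite facets of a subcube of dimension p + 1.  A subcube lies in Γ_n exactly
-- when its largest element (free coordinates set to 1) is a Fibonacci string.  Hence in a
-- maximal hypercube no fixed coordinate is 1 and the largest element is a maximal
-- Fibonacci string, and conversely; so f_{n,p} counts the maximal Fibonacci strings of
-- length n with p ones.  These are the words in the blocks 10 and 010 followed by
-- ε, 1 or 01; splitting off the first block gives the recurrence, and the generating
-- function is then checked coefficientwise.
module Submission where

open import Defs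
open import Data.Bool using (Bool; true; false; not; _≤_; b≤b; f≤t; _≟_)
open import Data.Bool.Properties using (⇔→≡) renaming (≤-refl to ≤ᵇ-refl)
open import Data.Empty using (⊥; ⊥-elim)
open import Data.Integer using (ℤ; +_; -_; _+_; _*_)
import Data.Integer.Properties as ℤ
open import Data.Integer.Solver using (module +-*-Solver)
open import Data.Nat as ℕ using (ℕ; zero; suc; _∸_; _≥_; s≤s)
open import Data.Nat.Properties using (suc-injective; 1+n≢n)
open import Data.Product using (Σ; Σ-syntax; ∃-syntax; _×_; _,_; proj₁)
open import Data.Sum as Sum using (_⊎_; inj₁; inj₂)
open import Data.Vec using (Vec; []; _∷_; _++_; map)
open import Data.Vec.Properties using (∷-injectiveʳ; ++-injectiveʳ; ≡-dec)
open import Data.Vec.Membership.Propositional using (_∈_)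
open import Data.Vec.Membership.Propositional.Properties
  using (∈-lookup; ∈-map⁺; ∈-++⁺ˡ; ∈-++⁺ʳ; fromAny)
open import Data.Vec.Relation.Binary.Pointwise.Inductive as Pointwise using (Pointwise; []; _∷_)
open import Data.Vec.Relation.Unary.All as All using ([]; _∷_)
import Data.Vec.Relation.Unary.All.Properties as All
open import Data.Vec.Relation.Unary.Any using (here; there; index)
import Data.Vec.Relation.Unary.Any.Properties as Any
import Data.Vec.Relation.Unary.AllPairs.Properties as AllPairs
open import Data.Vec.Relation.Unary.Unique.Propositional using (Unique; []; _∷_)
import Data.Vec.Relation.Unary.Unique.Propositional.Properties as Unique
open import Function using (_∘_; _∋_; id; mk⇔)
open import Relation.Binary.PropositionalEquality
open import Relation.Nullary using (¬_; yes; no)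

private
  variable
    k m n p : ℕ
    a b : Bool
    v w w′ x y z : Vec Bool n
    S : Subset n

dist-refl : (x : Vec Bool n) → dist x x ≡ 0
dist-refl []          = refl
dist-refl (false ∷ x) = dist-refl x
dist-refl (true ∷ x)  = dist-refl x

dist-sym : (x y : Vec Bool n) → dist x y ≡ dist y x
dist-sym []          []          = refl
dist-sym (false ∷ x) (false ∷ y) = dist-sym x y
dist-sym (true ∷ x)  (true ∷ y)  = dist-sym x y
dist-sym (false ∷ x) (true ∷ y)  = cong suc (dist-sym x y)
dist-sym (true ∷ x)  (false ∷ y) = cong suc (dist-sym x y)

dist≡0⇒≡ : (x y : Vec Bool n) → dist x y ≡ 0 → x ≡ y
dist≡0⇒≡ []          []          _ = refl
dist≡0⇒≡ (false ∷ x) (false ∷ y) e = cong (false ∷_) (dist≡0⇒≡ x y e)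
dist≡0⇒≡ (true ∷ x)  (true ∷ y)  e = cong (true ∷_) (dist≡0⇒≡ x y e)

dist-∷ : ∀ b (x y : Vec Bool n) → dist (b ∷ x) (b ∷ y) ≡ dist x y
dist-∷ false x y = refl
dist-∷ true  x y = refl

Adj-sym : (x y : Vec Bool n) → Adj x y → Adj y x
Adj-sym x y = trans (dist-sym y x)

Adj-∷-not⇒≡ : ∀ a (x y : Vec Bool n) → Adj (a ∷ x) (not a ∷ y) → x ≡ y
Adj-∷-not⇒≡ false x y e = dist≡0⇒≡ x y (suc-injective e)
Adj-∷-not⇒≡ true  x y e = dist≡0⇒≡ x y (suc-injective e)

-- Subcubes of Q_n

data Letter : Set where
  fixed : Bool → Letter
  free  : Letter

Pattern : ℕ → Set
Pattern = Vec Letter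

private
  variable
    c c′ : Letter
    P Q : Pattern n

dim : Pattern n → ℕ
dim []            = 0
dim (fixed _ ∷ P) = dim P
dim (free ∷ P)    = suc (dim P)

infix 4 _∈ₚ_ _⊆ₚ_ _⊑_

data _∈ₚ_ : Vec Bool n → Pattern n → Set where
  []    : [] ∈ₚ []
  fixed : v ∈ₚ P → b ∷ v ∈ₚ fixed b ∷ P
  free  : v ∈ₚ P → b ∷ v ∈ₚ free ∷ P

_⊆ₚ_ : Pattern n → Pattern n → Set
P ⊆ₚ Q = ∀ {v} → v ∈ₚ P → v ∈ₚ Q

top : Pattern n → Vec Bool n
top []            = []
top (fixed b ∷ P) = b ∷ top P
top (free ∷ P)    = true ∷ top P

top-∈ : (P : Pattern n) → top P ∈ₚ P
top-∈ []            = []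
top-∈ (fixed b ∷ P) = fixed (top-∈ P)
top-∈ (free ∷ P)    = free (top-∈ P)

embed : (P : Pattern n) → Vec Bool (dim P) → Vec Bool n
embed []            u       = []
embed (fixed b ∷ P) u       = b ∷ embed P u
embed (free ∷ P)    (b ∷ u) = b ∷ embed P u

embed-∈ : (P : Pattern n) (u : Vec Bool (dim P)) → embed P u ∈ₚ P
embed-∈ []            []      = []
embed-∈ (fixed b ∷ P) u       = fixed (embed-∈ P u)
embed-∈ (free ∷ P)    (b ∷ u) = free (embed-∈ P u)

∈ₚ⇒embed : v ∈ₚ P → ∃[ u ] embed P u ≡ v
∈ₚ⇒embed [] = [] , refl
∈ₚ⇒embed (fixed m) with ∈ₚ⇒embed m
... | u , refl = u , refl
∈ₚ⇒embed (free {b = b} m) with ∈ₚ⇒embed m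
... | u , refl = b ∷ u , refl

dist-embed : (P : Pattern n) (u w : Vec Bool (dim P)) → dist (embed P u) (embed P w) ≡ dist u w
dist-embed []            []          []          = refl
dist-embed (fixed b ∷ P) u           w           = trans (dist-∷ b _ _) (dist-embed P u w)
dist-embed (free ∷ P)    (false ∷ u) (false ∷ w) = dist-embed P u w
dist-embed (free ∷ P)    (true ∷ u)  (true ∷ w)  = dist-embed P u w
dist-embed (free ∷ P)    (false ∷ u) (true ∷ w)  = cong suc (dist-embed P u w)
dist-embed (free ∷ P)    (true ∷ u)  (false ∷ w) = cong suc (dist-embed P u w)

embed-injective : (P : Pattern n) (u w : Vec Bool (dim P)) → embed P u ≡ embed P w → u ≡ w
embed-injective P u w e = dist≡0⇒≡ u w (begin
  dist u w                     ≡⟨ dist-embed P u w ⟨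
  dist (embed P u) (embed P w) ≡⟨ cong (λ t → dist t (embed P w)) e ⟩
  dist (embed P w) (embed P w) ≡⟨ dist-refl (embed P w) ⟩
  0                            ∎)
  where open ≡-Reasoning

data _⊑_ : Pattern n → Pattern n → Set where
  []      : [] ⊑ []
  keep    : P ⊑ Q → c ∷ P ⊑ c ∷ Q
  release : P ⊑ Q → fixed b ∷ P ⊑ free ∷ Q

⊑-refl : P ⊑ P
⊑-refl {P = []}    = []
⊑-refl {P = _ ∷ P} = keep ⊑-refl

⊑-antisym : P ⊑ Q → Q ⊑ P → P ≡ Q
⊑-antisym []           []           = refl
⊑-antisym (keep P⊑Q)   (keep Q⊑P)   = cong (_ ∷_) (⊑-antisym P⊑Q Q⊑P)
⊑-antisym (release _)  ()

⊑⇒⊆ : P ⊑ Q → P ⊆ₚ Q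
⊑⇒⊆ []            []        = []
⊑⇒⊆ (keep P⊑Q)    (fixed m) = fixed (⊑⇒⊆ P⊑Q m)
⊑⇒⊆ (keep P⊑Q)    (free m)  = free (⊑⇒⊆ P⊑Q m)
⊑⇒⊆ (release P⊑Q) (fixed m) = free (⊑⇒⊆ P⊑Q m)

∷-⊆⁻ : (∀ {x} → x ∈ₚ P → b ∷ x ∈ₚ c ∷ P) → c ∷ P ⊆ₚ c′ ∷ Q → P ⊆ₚ Q
∷-⊆⁻ into P⊆Q m with P⊆Q (into m)
... | fixed m′ = m′
... | free m′  = m′

⊆⇒⊑ : (P Q : Pattern n) → P ⊆ₚ Q → P ⊑ Q
⊆⇒⊑ []            []            _   = []
⊆⇒⊑ (fixed a ∷ P) (fixed b ∷ Q) P⊆Q with P⊆Q (fixed (top-∈ P))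
... | fixed _ = keep (⊆⇒⊑ P Q (∷-⊆⁻ fixed P⊆Q))
⊆⇒⊑ (fixed a ∷ P) (free ∷ Q)    P⊆Q = release (⊆⇒⊑ P Q (∷-⊆⁻ fixed P⊆Q))
⊆⇒⊑ (free ∷ P)    (fixed false ∷ Q) P⊆Q with P⊆Q (free {b = true} (top-∈ P))
... | ()
⊆⇒⊑ (free ∷ P)    (fixed true ∷ Q)  P⊆Q with P⊆Q (free {b = false} (top-∈ P))
... | ()
⊆⇒⊑ (free ∷ P)    (free ∷ Q)    P⊆Q = keep (⊆⇒⊑ P Q (∷-⊆⁻ (free {b = false}) P⊆Q))

⊆-antisym : P ⊆ₚ Q → Q ⊆ₚ P → P ≡ Q
⊆-antisym {P = P} {Q} P⊆Q Q⊆P = ⊑-antisym (⊆⇒⊑ P Q P⊆Q) (⊆⇒⊑ Q P Q⊆P)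

∅ : ∀ n → Subset n
∅ zero    = leaf false
∅ (suc n) = node (∅ n) (∅ n)

∉∅ : (v : Vec Bool n) → member (∅ n) v ≡ false
∉∅ []          = refl
∉∅ (false ∷ v) = ∉∅ v
∉∅ (true ∷ v)  = ∉∅ v

⟦_⟧ : Pattern n → Subset n
⟦ [] ⟧              = leaf true
⟦ fixed false ∷ P ⟧ = node ⟦ P ⟧ (∅ _)
⟦ fixed true ∷ P ⟧  = node (∅ _) ⟦ P ⟧
⟦ free ∷ P ⟧        = node ⟦ P ⟧ ⟦ P ⟧

∈ₚ⇒∈⟦⟧ : v ∈ₚ P → v ∈S ⟦ P ⟧
∈ₚ⇒∈⟦⟧ []                    = refl
∈ₚ⇒∈⟦⟧ (fixed {b = false} m) = ∈ₚ⇒∈⟦⟧ m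
∈ₚ⇒∈⟦⟧ (fixed {b = true} m)  = ∈ₚ⇒∈⟦⟧ m
∈ₚ⇒∈⟦⟧ (free {b = false} m)  = ∈ₚ⇒∈⟦⟧ m
∈ₚ⇒∈⟦⟧ (free {b = true} m)   = ∈ₚ⇒∈⟦⟧ m

∈⟦⟧⇒∈ₚ : (P : Pattern n) (v : Vec Bool n) → v ∈S ⟦ P ⟧ → v ∈ₚ P
∈⟦⟧⇒∈ₚ []                []          _ = []
∈⟦⟧⇒∈ₚ (fixed false ∷ P) (false ∷ v) m = fixed (∈⟦⟧⇒∈ₚ P v m)
∈⟦⟧⇒∈ₚ (fixed true ∷ P)  (true ∷ v)  m = fixed (∈⟦⟧⇒∈ₚ P v m)
∈⟦⟧⇒∈ₚ (free ∷ P)        (false ∷ v) m = free (∈⟦⟧⇒∈ₚ P v m)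
∈⟦⟧⇒∈ₚ (free ∷ P)        (true ∷ v)  m = free (∈⟦⟧⇒∈ₚ P v m)
∈⟦⟧⇒∈ₚ (fixed false ∷ P) (true ∷ v)  m with () ← trans (sym (∉∅ v)) m
∈⟦⟧⇒∈ₚ (fixed true ∷ P)  (false ∷ v) m with () ← trans (sym (∉∅ v)) m

subset-ext : (S T : Subset n) → S ⊆S T → T ⊆S S → S ≡ T
subset-ext (leaf a)   (leaf b)     S⊆T T⊆S = cong leaf (⇔→≡ (mk⇔ (S⊆T []) (T⊆S [])))
subset-ext (node l r) (node l′ r′) S⊆T T⊆S = cong₂ node
  (subset-ext l l′ (S⊆T ∘ (false ∷_)) (T⊆S ∘ (false ∷_)))
  (subset-ext r r′ (S⊆T ∘ (true ∷_)) (T⊆S ∘ (true ∷_)))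

⟦⟧-injective : ⟦ P ⟧ ≡ ⟦ Q ⟧ → P ≡ Q
⟦⟧-injective {P = P} {Q} e = ⊆-antisym
  (λ m → ∈⟦⟧⇒∈ₚ Q _ (subst (_ ∈S_) e (∈ₚ⇒∈⟦⟧ m)))
  (λ m → ∈⟦⟧⇒∈ₚ P _ (subst (_ ∈S_) (sym e) (∈ₚ⇒∈⟦⟧ m)))

-- The image of an embedding of Q_p in Q_n is a subcube

data Opposite : Pattern n → Pattern n → Set where
  here  : Opposite (fixed b ∷ P) (fixed (not b) ∷ P)
  there : Opposite P Q → Opposite (c ∷ P) (c ∷ Q)

span : {P Q : Pattern n} → Opposite P Q → Pattern n
span (here {P = P})   = free ∷ P
span (there {c = c} o) = c ∷ span o

dim-span : (o : Opposite P Q) → dim (span o) ≡ suc (dim P)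
dim-span here                  = refl
dim-span (there {c = fixed _} o) = dim-span o
dim-span (there {c = free} o)    = cong suc (dim-span o)

⊆span-left : (o : Opposite P Q) → P ⊆ₚ span o
⊆span-left here      (fixed m) = free m
⊆span-left (there o) (fixed m) = fixed (⊆span-left o m)
⊆span-left (there o) (free m)  = free (⊆span-left o m)

⊆span-right : (o : Opposite P Q) → Q ⊆ₚ span o
⊆span-right here      (fixed m) = free m
⊆span-right (there o) (fixed m) = fixed (⊆span-right o m)
⊆span-right (there o) (free m)  = free (⊆span-right o m)

span-⊆ : (o : Opposite P Q) → v ∈ₚ span o → v ∈ₚ P ⊎ v ∈ₚ Q
span-⊆ (here {b = false}) (free {b = false} m) = inj₁ (fixed m)
span-⊆ (here {b = false}) (free {b = true} m)  = inj₂ (fixed m)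
span-⊆ (here {b = true})  (free {b = true} m)  = inj₁ (fixed m)
span-⊆ (here {b = true})  (free {b = false} m) = inj₂ (fixed m)
span-⊆ (there o) (fixed m) = Sum.map fixed fixed (span-⊆ o m)
span-⊆ (there o) (free m)  = Sum.map free free (span-⊆ o m)

Matched : Pattern n → Pattern n → Set
Matched P Q = ∀ {x} → x ∈ₚ P → ∃[ y ] y ∈ₚ Q × Adj x y

Disjoint : Pattern n → Pattern n → Set
Disjoint P Q = ∀ {x} → x ∈ₚ P → x ∈ₚ Q → ⊥

Disjoint-sym : Disjoint P Q → Disjoint Q P
Disjoint-sym P∩Q=∅ m m′ = P∩Q=∅ m′ m

Disjoint-∷⁻ : ∀ c → Disjoint (c ∷ P) (c ∷ Q) → Disjoint P Q
Disjoint-∷⁻ (fixed b) P∩Q=∅ m m′ = P∩Q=∅ (fixed m) (fixed m′)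
Disjoint-∷⁻ free      P∩Q=∅ m m′ = P∩Q=∅ (free {b = false} m) (free m′)

Matched-fixed⁻ : Matched (fixed a ∷ P) (fixed a ∷ Q) → Matched P Q
Matched-fixed⁻ {a = a} match m with match (fixed m)
... | _ ∷ y , fixed m′ , adj = y , m′ , trans (sym (dist-∷ a _ y)) adj

-- A partner across the free coordinate has the same tail, so the two subcubes would meet.
Matched-free⁻ : Matched (free ∷ P) (free ∷ Q) → Disjoint (free ∷ P) (free ∷ Q) → Matched P Q
Matched-free⁻ match P∩Q=∅ {x} m with match (free {b = false} m)
... | false ∷ y , free m′ , adj = y , m′ , adj
... | true ∷ y , free m′ , adj with refl ← Adj-∷-not⇒≡ false x y adj =
  ⊥-elim (P∩Q=∅ (free {b = false} m) (free m′))

Matched-flip⇒⊆ : Matched (fixed a ∷ P) (fixed (not a) ∷ Q) → P ⊆ₚ Q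
Matched-flip⇒⊆ {a = a} match {x} m with match (fixed m)
... | _ ∷ y , fixed m′ , adj with refl ← Adj-∷-not⇒≡ a x y adj = m′

free-fixed-unmatched : Matched (free ∷ Q) (fixed a ∷ P) → ¬ Disjoint (fixed a ∷ P) (free ∷ Q)
free-fixed-unmatched {Q = Q} {a = false} match P∩Q=∅ with match (free {b = true} (top-∈ Q))
... | false ∷ x , fixed m , adj with refl ← Adj-∷-not⇒≡ true (top Q) x adj =
  P∩Q=∅ (fixed m) (free (top-∈ Q))
free-fixed-unmatched {Q = Q} {a = true} match P∩Q=∅ with match (free {b = false} (top-∈ Q))
... | true ∷ x , fixed m , adj with refl ← Adj-∷-not⇒≡ false (top Q) x adj =
  P∩Q=∅ (fixed m) (free (top-∈ Q))

opposite-heads : Matched (fixed a ∷ P) (fixed (not a) ∷ Q) → Q ⊆ₚ P →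
                 Opposite (fixed a ∷ P) (fixed (not a) ∷ Q)
opposite-heads match Q⊆P with refl ← ⊆-antisym (Matched-flip⇒⊆ match) Q⊆P = here

matched⇒opposite : (P Q : Pattern n) → Matched P Q → Matched Q P → Disjoint P Q → Opposite P Q
matched⇒opposite [] [] _ _ P∩Q=∅ = ⊥-elim (P∩Q=∅ [] [])
matched⇒opposite (fixed false ∷ P) (fixed false ∷ Q) PQ QP P∩Q=∅ =
  there (matched⇒opposite P Q (Matched-fixed⁻ PQ) (Matched-fixed⁻ QP) (Disjoint-∷⁻ _ P∩Q=∅))
matched⇒opposite (fixed true ∷ P) (fixed true ∷ Q) PQ QP P∩Q=∅ =
  there (matched⇒opposite P Q (Matched-fixed⁻ PQ) (Matched-fixed⁻ QP) (Disjoint-∷⁻ _ P∩Q=∅))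
matched⇒opposite (fixed false ∷ P) (fixed true ∷ Q) PQ QP _ = opposite-heads PQ (Matched-flip⇒⊆ QP)
matched⇒opposite (fixed true ∷ P) (fixed false ∷ Q) PQ QP _ = opposite-heads PQ (Matched-flip⇒⊆ QP)
matched⇒opposite (free ∷ P) (free ∷ Q) PQ QP P∩Q=∅ =
  there (matched⇒opposite P Q (Matched-free⁻ PQ P∩Q=∅) (Matched-free⁻ QP (Disjoint-sym P∩Q=∅))
                              (Disjoint-∷⁻ _ P∩Q=∅))
matched⇒opposite (fixed _ ∷ P) (free ∷ Q) _ QP P∩Q=∅ = ⊥-elim (free-fixed-unmatched QP P∩Q=∅)
matched⇒opposite (free ∷ P) (fixed _ ∷ Q) PQ _ P∩Q=∅ =
  ⊥-elim (free-fixed-unmatched PQ (Disjoint-sym P∩Q=∅))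

IsCubeEmbedding : (Vec Bool p → Vec Bool n) → Set
IsCubeEmbedding φ = (∀ {u w} → φ u ≡ φ w → u ≡ w) × (∀ {u w} → Adj u w → Adj (φ u) (φ w))

IsCubeEmbedding-∷ : ∀ b {φ : Vec Bool (suc p) → Vec Bool n} →
                    IsCubeEmbedding φ → IsCubeEmbedding (φ ∘ (b ∷_))
IsCubeEmbedding-∷ b (inj , adj) = (∷-injectiveʳ ∘ inj) , λ {u} {w} e → adj (trans (dist-∷ b u w) e)

IsImageOf : Pattern n → (Vec Bool p → Vec Bool n) → Set
IsImageOf {p = p} P φ = dim P ≡ p × (∀ u → φ u ∈ₚ P) × (∀ {v} → v ∈ₚ P → ∃[ u ] φ u ≡ v)

point : Vec Bool n → Pattern n
point = map fixed

dim-point : (v : Vec Bool n) → dim (point v) ≡ 0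
dim-point []      = refl
dim-point (b ∷ v) = dim-point v

∈-point : (v : Vec Bool n) → v ∈ₚ point v
∈-point []      = []
∈-point (b ∷ v) = fixed (∈-point v)

∈-point⁻ : w ∈ₚ point v → w ≡ v
∈-point⁻ {v = []}    []        = refl
∈-point⁻ {v = b ∷ v} (fixed m) = cong (b ∷_) (∈-point⁻ m)

image-subcube : (φ : Vec Bool p → Vec Bool n) → IsCubeEmbedding φ → Σ[ P ∈ Pattern n ] IsImageOf P φ
image-subcube {zero} φ _ =
  point (φ []) , dim-point (φ []) , (λ { [] → ∈-point _ }) , λ m → [] , sym (∈-point⁻ m)
image-subcube {suc p} φ emb@(inj , adj)
  with P₀ , dim₀ , in₀ , out₀ ← image-subcube (φ ∘ (false ∷_)) (IsCubeEmbedding-∷ false emb)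
     | P₁ , _    , in₁ , out₁ ← image-subcube (φ ∘ (true ∷_)) (IsCubeEmbedding-∷ true emb)
  = span o , trans (dim-span o) (cong suc dim₀) , into , onto
  where
  rung : ∀ u → Adj (φ (false ∷ u)) (φ (true ∷ u))
  rung u = adj (cong suc (dist-refl u))

  matched₀₁ : Matched P₀ P₁
  matched₀₁ m with u , refl ← out₀ m = φ (true ∷ u) , in₁ u , rung u

  matched₁₀ : Matched P₁ P₀
  matched₁₀ m with u , refl ← out₁ m = φ (false ∷ u) , in₀ u , Adj-sym (φ (false ∷ u)) _ (rung u)

  disjoint : Disjoint P₀ P₁
  disjoint m m′ with u , refl ← out₀ m | w , e ← out₁ m′ with () ← inj e

  o : Opposite P₀ P₁
  o = matched⇒opposite P₀ P₁ matched₀₁ matched₁₀ disjoint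

  into : ∀ u → φ u ∈ₚ span o
  into (false ∷ u) = ⊆span-left o (in₀ u)
  into (true ∷ u)  = ⊆span-right o (in₁ u)

  onto : ∀ {v} → v ∈ₚ span o → ∃[ u ] φ u ≡ v
  onto m with span-⊆ o m
  ... | inj₁ m₀ with u , e ← out₀ m₀ = false ∷ u , e
  ... | inj₂ m₁ with u , e ← out₁ m₁ = true ∷ u , e

-- Fibonacci strings and Fibonacci subcubes

data Fibonacci : Vec Bool n → Set where
  []   : Fibonacci []
  0∷_  : Fibonacci v → Fibonacci (false ∷ v)
  [1]  : Fibonacci (true ∷ [])
  10∷_ : Fibonacci v → Fibonacci (true ∷ false ∷ v)

noTwoOnes-0∷ : (v : Vec Bool n) → noTwoOnes (false ∷ v) ≡ noTwoOnes v
noTwoOnes-0∷ []      = refl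
noTwoOnes-0∷ (b ∷ v) = refl

Fib⇒Fibonacci : (v : Vec Bool n) → Fib v → Fibonacci v
Fib⇒Fibonacci []                 _ = []
Fib⇒Fibonacci (false ∷ [])       _ = 0∷ []
Fib⇒Fibonacci (true ∷ [])        _ = [1]
Fib⇒Fibonacci (false ∷ b ∷ v)    f = 0∷ Fib⇒Fibonacci (b ∷ v) f
Fib⇒Fibonacci (true ∷ false ∷ v) f = 10∷ Fib⇒Fibonacci v (trans (sym (noTwoOnes-0∷ v)) f)
Fib⇒Fibonacci (true ∷ true ∷ v)  ()

Fibonacci⇒Fib : Fibonacci v → Fib v
Fibonacci⇒Fib []               = refl
Fibonacci⇒Fib (0∷_ {v = v} f)  = trans (noTwoOnes-0∷ v) (Fibonacci⇒Fib f)
Fibonacci⇒Fib [1]              = refl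
Fibonacci⇒Fib (10∷_ {v = v} f) = trans (noTwoOnes-0∷ v) (Fibonacci⇒Fib f)

_≼_ : Vec Bool n → Vec Bool n → Set
_≼_ = Pointwise _≤_

infix 4 _≼_

≼-refl : x ≼ x
≼-refl = Pointwise.refl ≤ᵇ-refl

Fibonacci-≼ : x ≼ y → Fibonacci y → Fibonacci x
Fibonacci-≼ []                []      = []
Fibonacci-≼ (b≤b ∷ x≼y)       (0∷ f)  = 0∷ Fibonacci-≼ x≼y f
Fibonacci-≼ (f≤t ∷ [])        [1]     = 0∷ []
Fibonacci-≼ (b≤b ∷ [])        [1]     = [1]
Fibonacci-≼ (f≤t ∷ b≤b ∷ x≼y) (10∷ f) = 0∷ 0∷ Fibonacci-≼ x≼y f
Fibonacci-≼ (b≤b ∷ b≤b ∷ x≼y) (10∷ f) = 10∷ Fibonacci-≼ x≼y f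

∈ₚ⇒≼top : v ∈ₚ P → v ≼ top P
∈ₚ⇒≼top []                   = []
∈ₚ⇒≼top (fixed m)            = b≤b ∷ ∈ₚ⇒≼top m
∈ₚ⇒≼top (free {b = false} m) = f≤t ∷ ∈ₚ⇒≼top m
∈ₚ⇒≼top (free {b = true} m)  = b≤b ∷ ∈ₚ⇒≼top m

AllFibonacci : Pattern n → Set
AllFibonacci P = ∀ {v} → v ∈ₚ P → Fibonacci v

Fibonacci-top⇒AllFibonacci : Fibonacci (top P) → AllFibonacci P
Fibonacci-top⇒AllFibonacci f m = Fibonacci-≼ (∈ₚ⇒≼top m) f

subcube-hypercube : (P : Pattern n) → AllFibonacci P → IsHypercube n (dim P) ⟦ P ⟧
subcube-hypercube P fib =
  (λ v m → Fibonacci⇒Fib (fib (∈⟦⟧⇒∈ₚ P v m))) ,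
  embed P ,
  (λ u → ∈ₚ⇒∈⟦⟧ (embed-∈ P u)) ,
  (λ v m → ∈ₚ⇒embed (∈⟦⟧⇒∈ₚ P v m)) ,
  embed-injective P ,
  λ u w → trans (dist-embed P u w) , trans (sym (dist-embed P u w))

hypercube⇒subcube : IsHypercube n p S → Σ[ P ∈ Pattern n ] dim P ≡ p × S ≡ ⟦ P ⟧ × AllFibonacci P
hypercube⇒subcube {S = S} (fib , φ , φ∈S , S⊆φ , inj , adj)
  with P , dimP , φ∈P , P⊆φ ← image-subcube φ ((λ {u} {w} → inj u w) , λ {u} {w} → proj₁ (adj u w))
  = P , dimP , S≡⟦P⟧ , λ m → Fib⇒Fibonacci _ (fib _ (∈S m))
  where
  ∈S : v ∈ₚ P → v ∈S S
  ∈S m with u , refl ← P⊆φ m = φ∈S u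

  S≡⟦P⟧ : S ≡ ⟦ P ⟧
  S≡⟦P⟧ = subset-ext S ⟦ P ⟧
    (λ v m → let u , φu≡v = S⊆φ v m in ∈ₚ⇒∈⟦⟧ (subst (_∈ₚ P) φu≡v (φ∈P u)))
    (λ v m → ∈S (∈⟦⟧⇒∈ₚ P v m))

-- Maximal Fibonacci strings

Maximal : Vec Bool n → Set
Maximal z = ∀ z′ → z ≼ z′ → Fibonacci z′ → z′ ≡ z

data MaxFib : Vec Bool n → Set where
  []    : MaxFib []
  [1]   : MaxFib (true ∷ [])
  [01]  : MaxFib (false ∷ true ∷ [])
  10∷_  : MaxFib w → MaxFib (true ∷ false ∷ w)
  010∷_ : MaxFib w → MaxFib (false ∷ true ∷ false ∷ w)

MaxFib⇒Fibonacci : MaxFib z → Fibonacci z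
MaxFib⇒Fibonacci []       = []
MaxFib⇒Fibonacci [1]      = [1]
MaxFib⇒Fibonacci [01]     = 0∷ [1]
MaxFib⇒Fibonacci (10∷ m)  = 10∷ MaxFib⇒Fibonacci m
MaxFib⇒Fibonacci (010∷ m) = 0∷ 10∷ MaxFib⇒Fibonacci m

MaxFib⇒Maximal : MaxFib z → Maximal z
MaxFib⇒Maximal []       _ []                   _          = refl
MaxFib⇒Maximal [1]      _ (b≤b ∷ [])           _          = refl
MaxFib⇒Maximal [01]     _ (_ ∷ b≤b ∷ [])       (0∷ [1])   = refl
MaxFib⇒Maximal (10∷ m)  _ (b≤b ∷ _ ∷ z≼z′)     (10∷ f)    =
  cong (λ t → true ∷ false ∷ t) (MaxFib⇒Maximal m _ z≼z′ f)
MaxFib⇒Maximal (010∷ m) _ (_ ∷ b≤b ∷ _ ∷ z≼z′) (0∷ 10∷ f) =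
  cong (λ t → false ∷ true ∷ false ∷ t) (MaxFib⇒Maximal m _ z≼z′ f)

Maximal-++⁻ : (u : Vec Bool m) → (∀ {n} {w : Vec Bool n} → Fibonacci w → Fibonacci (u ++ w)) →
              Maximal (u ++ w) → Maximal w
Maximal-++⁻ u fib max z′ w≼z′ f =
  ++-injectiveʳ u u (max (u ++ z′) (Pointwise.++⁺ ≼-refl w≼z′) (fib f))

Maximal⇒MaxFib : Fibonacci z → Maximal z → MaxFib z
Maximal⇒MaxFib []         _   = []
Maximal⇒MaxFib [1]        _   = [1]
Maximal⇒MaxFib (0∷ [1])   _   = [01]
Maximal⇒MaxFib (10∷ f)    max = 10∷ Maximal⇒MaxFib f (Maximal-++⁻ (true ∷ false ∷ []) 10∷_ max)
Maximal⇒MaxFib (0∷ 10∷ f) max =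
  010∷ Maximal⇒MaxFib f (Maximal-++⁻ (false ∷ true ∷ false ∷ []) (0∷_ ∘ 10∷_) max)
Maximal⇒MaxFib (0∷ [])    max with () ← max _ (f≤t ∷ []) [1]
Maximal⇒MaxFib (0∷ 0∷ f)  max with () ← max _ (f≤t ∷ ≼-refl) (10∷ f)

-- Maximal hypercubes are the subcubes below maximal Fibonacci strings

↓_ : Vec Bool n → Pattern n
↓ []          = []
↓ (true ∷ z)  = free ∷ ↓ z
↓ (false ∷ z) = fixed false ∷ ↓ z

weight : Vec Bool n → ℕ
weight z = dim (↓ z)

top-↓ : (z : Vec Bool n) → top (↓ z) ≡ z
top-↓ []          = refl
top-↓ (true ∷ z)  = cong (true ∷_) (top-↓ z)
top-↓ (false ∷ z) = cong (false ∷_) (top-↓ z)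

Fibonacci⇒AllFibonacci-↓ : Fibonacci z → AllFibonacci (↓ z)
Fibonacci⇒AllFibonacci-↓ {z = z} f = Fibonacci-top⇒AllFibonacci (subst Fibonacci (sym (top-↓ z)) f)

↓-mono : x ≼ y → ↓ x ⊑ ↓ y
↓-mono []                  = []
↓-mono (f≤t ∷ x≼y)         = release (↓-mono x≼y)
↓-mono (b≤b {true} ∷ x≼y)  = keep (↓-mono x≼y)
↓-mono (b≤b {false} ∷ x≼y) = keep (↓-mono x≼y)

⊑⇒top≼ : P ⊑ Q → top P ≼ top Q
⊑⇒top≼ []                        = []
⊑⇒top≼ (keep {c = fixed _} P⊑Q)  = b≤b ∷ ⊑⇒top≼ P⊑Q
⊑⇒top≼ (keep {c = free} P⊑Q)     = b≤b ∷ ⊑⇒top≼ P⊑Q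
⊑⇒top≼ (release {b = false} P⊑Q) = f≤t ∷ ⊑⇒top≼ P⊑Q
⊑⇒top≼ (release {b = true} P⊑Q)  = b≤b ∷ ⊑⇒top≼ P⊑Q

↓⊑-top⇒≡ : (z : Vec Bool n) → ↓ z ⊑ Q → top Q ≡ z → Q ≡ ↓ z
↓⊑-top⇒≡ []          []         _ = refl
↓⊑-top⇒≡ (true ∷ z)  (keep z⊑Q) e = cong (free ∷_) (↓⊑-top⇒≡ z z⊑Q (∷-injectiveʳ e))
↓⊑-top⇒≡ (false ∷ z) (keep z⊑Q) e = cong (fixed false ∷_) (↓⊑-top⇒≡ z z⊑Q (∷-injectiveʳ e))

↓-injective : ⟦ ↓ x ⟧ ≡ ⟦ ↓ y ⟧ → x ≡ y
↓-injective {x = x} {y} e = begin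
  x         ≡⟨ top-↓ x ⟨
  top (↓ x) ≡⟨ cong top (⟦⟧-injective e) ⟩
  top (↓ y) ≡⟨ top-↓ y ⟩
  y         ∎
  where open ≡-Reasoning

_⊏₁_ : Pattern n → Pattern n → Set
P ⊏₁ Q = P ⊑ Q × dim Q ≡ suc (dim P)

Unextendable : Pattern n → Set
Unextendable P = ∀ {Q} → P ⊏₁ Q → ¬ AllFibonacci Q

-- Releasing a fixed 1 does not change the top.
no-fixed-one : (P : Pattern n) → (∀ {Q} → P ⊏₁ Q → top Q ≢ top P) → P ≡ ↓ top P
no-fixed-one []                _     = refl
no-fixed-one (fixed true ∷ P)  never = ⊥-elim (never (release ⊑-refl , refl) refl)
no-fixed-one (fixed false ∷ P) never = cong (fixed false ∷_) (no-fixed-one P λ (P⊑Q , dimQ) e →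
  never (keep P⊑Q , dimQ) (cong (false ∷_) e))
no-fixed-one (free ∷ P)        never = cong (free ∷_) (no-fixed-one P λ (P⊑Q , dimQ) e →
  never (keep P⊑Q , cong suc dimQ) (cong (true ∷_) e))

≼-step : x ≼ y → y ≢ x → Σ[ z ∈ Vec Bool _ ] x ≼ z × z ≼ y × weight z ≡ suc (weight x)
≼-step []                          y≢x = ⊥-elim (y≢x refl)
≼-step {x = false ∷ x} (f≤t ∷ x≼y) _ = true ∷ x , f≤t ∷ ≼-refl , b≤b ∷ x≼y , refl
≼-step {x = a ∷ x}     (b≤b ∷ x≼y) y≢x
  with z , x≼z , z≼y , wz ← ≼-step x≼y (y≢x ∘ cong (a ∷_))
  = a ∷ z , b≤b ∷ x≼z , b≤b ∷ z≼y , weight-∷ a wz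
  where
  weight-∷ : ∀ a → weight z ≡ suc (weight x) → weight (a ∷ z) ≡ suc (weight (a ∷ x))
  weight-∷ true  = cong suc
  weight-∷ false = id

Unextendable⇒Maximal : Unextendable (↓ z) → Maximal z
Unextendable⇒Maximal {z = z} unext z′ z≼z′ f with ≡-dec _≟_ z′ z
... | yes z′≡z = z′≡z
... | no z′≢z with y , z≼y , y≼z′ , wy ← ≼-step z≼z′ z′≢z =
  ⊥-elim (unext (↓-mono z≼y , wy) (Fibonacci⇒AllFibonacci-↓ (Fibonacci-≼ y≼z′ f)))

maximal⇒unextendable : IsMaximalHypercube n (dim P) ⟦ P ⟧ → Unextendable P
maximal⇒unextendable {n = n} {P = P} (_ , no-larger) {Q} (P⊑Q , dimQ) fibQ =
  no-larger (⟦ Q ⟧ , ⟦P⟧⊆⟦Q⟧ , subst (λ k → IsHypercube n k ⟦ Q ⟧) dimQ (subcube-hypercube Q fibQ))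
  where
  ⟦P⟧⊆⟦Q⟧ : ⟦ P ⟧ ⊆S ⟦ Q ⟧
  ⟦P⟧⊆⟦Q⟧ v m = ∈ₚ⇒∈⟦⟧ (⊑⇒⊆ P⊑Q (∈⟦⟧⇒∈ₚ P v m))

maximal-hypercube⇒↓ : IsMaximalHypercube n p S →
                      Σ[ z ∈ Vec Bool n ] MaxFib z × weight z ≡ p × S ≡ ⟦ ↓ z ⟧
maximal-hypercube⇒↓ {S = S} max@(cube , _)
  with P , refl , refl , fib ← hypercube⇒subcube {S = S} cube =
  top P , Maximal⇒MaxFib fib-top (Unextendable⇒Maximal (subst Unextendable P≡↓ unext)) ,
  cong dim (sym P≡↓) , cong ⟦_⟧ P≡↓
  where
  unext : Unextendable P
  unext = maximal⇒unextendable max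

  fib-top : Fibonacci (top P)
  fib-top = fib (top-∈ P)

  P≡↓ : P ≡ ↓ top P
  P≡↓ = no-fixed-one P λ P⊏Q topQ≡topP →
    unext P⊏Q (Fibonacci-top⇒AllFibonacci (subst Fibonacci (sym topQ≡topP) fib-top))

↓-maximal-hypercube : MaxFib z → IsMaximalHypercube n (weight z) ⟦ ↓ z ⟧
↓-maximal-hypercube {n = n} {z = z} mf = subcube-hypercube (↓ z) fib , no-larger
  where
  fib : AllFibonacci (↓ z)
  fib = Fibonacci⇒AllFibonacci-↓ (MaxFib⇒Fibonacci mf)

  no-larger : ¬ (Σ[ T ∈ Subset n ] ⟦ ↓ z ⟧ ⊆S T × IsHypercube n (suc (weight z)) T)
  no-larger (T , ↓z⊆T , cube) with Q , dimQ , refl , fibQ ← hypercube⇒subcube {S = T} cube =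
    1+n≢n (trans (sym dimQ) (cong dim Q≡↓z))
    where
    ↓z⊑Q : ↓ z ⊑ Q
    ↓z⊑Q = ⊆⇒⊑ (↓ z) Q λ m → ∈⟦⟧⇒∈ₚ Q _ (↓z⊆T _ (∈ₚ⇒∈⟦⟧ m))

    Q≡↓z : Q ≡ ↓ z
    Q≡↓z = ↓⊑-top⇒≡ z ↓z⊑Q (MaxFib⇒Maximal mf (top Q)
      (subst (_≼ top Q) (top-↓ z) (⊑⇒top≼ ↓z⊑Q)) (fibQ (top-∈ Q)))

-- Counting maximal hypercubes

C′ : ℕ → Poly
C′ 0                   = constP 1
C′ 1                   = linP 1
C′ 2                   = linP 2
C′ (suc (suc (suc n))) = x· (C′ (suc n) +P C′ n)

maxFibs : ∀ n p → Vec (Vec Bool n) (C′ n p)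
maxFibs 0 0                         = [] ∷ []
maxFibs 0 (suc p)                   = []
maxFibs 1 0                         = []
maxFibs 1 1                         = (true ∷ []) ∷ []
maxFibs 1 (suc (suc p))             = []
maxFibs 2 0                         = []
maxFibs 2 1                         = (true ∷ false ∷ []) ∷ (false ∷ true ∷ []) ∷ []
maxFibs 2 (suc (suc p))             = []
maxFibs (suc (suc (suc n))) 0       = []
maxFibs (suc (suc (suc n))) (suc p) =
  map (λ w → true ∷ false ∷ w) (maxFibs (suc n) p) ++
  map (λ w → false ∷ true ∷ false ∷ w) (maxFibs n p)

∈maxFibs⁺ : MaxFib z → z ∈ maxFibs n (weight z)
∈maxFibs⁺ []                   = here refl
∈maxFibs⁺ [1]                  = here refl
∈maxFibs⁺ [01]                 = there (here refl)
∈maxFibs⁺ (10∷_ {w = []} [])   = here refl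
∈maxFibs⁺ (10∷_ {w = _ ∷ _} m) = ∈-++⁺ˡ (∈-map⁺ _ (∈maxFibs⁺ m))
∈maxFibs⁺ (010∷ m)             = ∈-++⁺ʳ _ (∈-map⁺ _ (∈maxFibs⁺ m))

∈maxFibs⁻ : ∀ n p {z : Vec Bool n} → z ∈ maxFibs n p → MaxFib z × weight z ≡ p
∈maxFibs⁻ 0 0 (here refl)         = [] , refl
∈maxFibs⁻ 1 1 (here refl)         = [1] , refl
∈maxFibs⁻ 2 1 (here refl)         = 10∷ [] , refl
∈maxFibs⁻ 2 1 (there (here refl)) = [01] , refl
∈maxFibs⁻ (suc (suc (suc n))) (suc p) z∈ with Any.++⁻ (map _ (maxFibs (suc n) p)) z∈
... | inj₁ z∈₁ with w , w∈ , refl ← fromAny (Any.map⁻ z∈₁)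
                with m , refl ← ∈maxFibs⁻ (suc n) p w∈ = 10∷ m , refl
... | inj₂ z∈₂ with w , w∈ , refl ← fromAny (Any.map⁻ z∈₂)
                with m , refl ← ∈maxFibs⁻ n p w∈ = 010∷ m , refl

maxFibs-unique : ∀ n p → Unique (maxFibs n p)
maxFibs-unique 0 0                         = [] ∷ []
maxFibs-unique 0 (suc p)                   = []
maxFibs-unique 1 0                         = []
maxFibs-unique 1 1                         = [] ∷ []
maxFibs-unique 1 (suc (suc p))             = []
maxFibs-unique 2 0                         = []
maxFibs-unique 2 1                         = ((λ ()) ∷ []) ∷ [] ∷ []
maxFibs-unique 2 (suc (suc p))             = []
maxFibs-unique (suc (suc (suc n))) 0       = []
maxFibs-unique (suc (suc (suc n))) (suc p) = AllPairs.++⁺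
  (Unique.map⁺ (∷-injectiveʳ ∘ ∷-injectiveʳ) (maxFibs-unique (suc n) p))
  (Unique.map⁺ (∷-injectiveʳ ∘ ∷-injectiveʳ ∘ ∷-injectiveʳ) (maxFibs-unique n p))
  (All.map⁺ (All.universal (λ _ → All.map⁺ (All.universal (λ _ → 10≢010) _)) _))
  where
  10≢010 : (Vec Bool (suc (suc (suc n))) ∋ true ∷ false ∷ w) ≢ false ∷ true ∷ false ∷ w′
  10≢010 ()

Unique⇒HasCount : {Φ : Subset n → Set} (xs : Vec (Subset n) k) → Unique xs →
                  (∀ {S} → Φ S → S ∈ xs) → (∀ {S} → S ∈ xs → Φ S) → HasCount Φ k
Unique⇒HasCount xs unique complete sound =
  xs , Unique.lookup-injective unique ,
  λ S → (λ ΦS → let S∈ = complete ΦS in index S∈ , sym (Any.lookup-index S∈)) ,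
        (λ (i , e) → sound (subst (_∈ xs) e (∈-lookup i xs)))

maximal-hypercubes-count : ∀ n p → HasCount (IsMaximalHypercube n p) (C′ n p)
maximal-hypercubes-count n p = Unique⇒HasCount (map (⟦_⟧ ∘ ↓_) (maxFibs n p))
  (Unique.map⁺ ↓-injective (maxFibs-unique n p)) complete sound
  where
  complete : IsMaximalHypercube n p S → S ∈ map (⟦_⟧ ∘ ↓_) (maxFibs n p)
  complete {S} max with z , mf , refl , refl ← maximal-hypercube⇒↓ {S = S} max =
    ∈-map⁺ _ (∈maxFibs⁺ mf)

  sound : S ∈ map (⟦_⟧ ∘ ↓_) (maxFibs n p) → IsMaximalHypercube n p S
  sound S∈ with z , z∈ , refl ← fromAny (Any.map⁻ S∈)
           with mf , refl ← ∈maxFibs⁻ n p z∈ = ↓-maximal-hypercube mf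

-- The generating function

sumTo-suc : ∀ n (f : ℕ → ℤ) → sumTo (suc n) f ≡ f 0 + sumTo n (f ∘ suc)
sumTo-suc zero    f = refl
sumTo-suc (suc n) f = trans (cong (_+ f (suc (suc n))) (sumTo-suc n f)) (ℤ.+-assoc (f 0) _ _)

sumTo-zero : ∀ n {f : ℕ → ℤ} → (∀ j → f j ≡ + 0) → sumTo n f ≡ + 0
sumTo-zero zero    f≡0 = f≡0 0
sumTo-zero (suc n) f≡0 rewrite sumTo-zero n f≡0 | f≡0 (suc n) = refl

antidiagonal₀₁ : (ℕ → ℕ → ℤ) → ℕ → ℤ
antidiagonal₀₁ h zero    = h 0 0
antidiagonal₀₁ h (suc p) = h (suc p) 0 + h p 1

sumTo-antidiagonal₀₁ : ∀ p (h : ℕ → ℕ → ℤ) → (∀ j l → h j (suc (suc l)) ≡ + 0) →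
                       sumTo p (λ j → h j (p ∸ j)) ≡ antidiagonal₀₁ h p
sumTo-antidiagonal₀₁ zero    h h≡0 = refl
sumTo-antidiagonal₀₁ (suc p) h h≡0 = begin
  sumTo (suc p) (λ j → h j (suc p ∸ j))           ≡⟨ sumTo-suc p _ ⟩
  h 0 (suc p) + sumTo p (λ j → h (suc j) (p ∸ j)) ≡⟨ cong (_+_ (h 0 (suc p)))
                                                      (sumTo-antidiagonal₀₁ p _ (h≡0 ∘ suc)) ⟩
  h 0 (suc p) + antidiagonal₀₁ (h ∘ suc) p        ≡⟨ absorb p ⟩
  antidiagonal₀₁ h (suc p)                        ∎
  where
  open ≡-Reasoning
  absorb : ∀ p → h 0 (suc p) + antidiagonal₀₁ (h ∘ suc) p ≡ antidiagonal₀₁ h (suc p)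
  absorb zero                    = ℤ.+-comm (h 0 1) (h 1 0)
  absorb (suc p) rewrite h≡0 0 p = ℤ.+-identityˡ _

antidiagonal₀₂₃ : (ℕ → ℕ → ℤ) → ℕ → ℤ
antidiagonal₀₂₃ h 0                   = h 0 0
antidiagonal₀₂₃ h 1                   = h 1 0
antidiagonal₀₂₃ h 2                   = h 2 0 + h 0 2
antidiagonal₀₂₃ h (suc (suc (suc n))) = h (suc (suc (suc n))) 0 + h (suc n) 2 + h n 3

sumTo-antidiagonal₀₂₃ : ∀ n (h : ℕ → ℕ → ℤ) → (∀ i → h i 1 ≡ + 0) →
                        (∀ i k → h i (suc (suc (suc (suc k)))) ≡ + 0) →
                        sumTo n (λ i → h i (n ∸ i)) ≡ antidiagonal₀₂₃ h n
sumTo-antidiagonal₀₂₃ zero    h h₁≡0 h₄≡0 = refl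
sumTo-antidiagonal₀₂₃ (suc n) h h₁≡0 h₄≡0 = begin
  sumTo (suc n) (λ i → h i (suc n ∸ i))           ≡⟨ sumTo-suc n _ ⟩
  h 0 (suc n) + sumTo n (λ i → h (suc i) (n ∸ i)) ≡⟨ cong (_+_ (h 0 (suc n))) (sumTo-antidiagonal₀₂₃ n _
                                                                               (h₁≡0 ∘ suc) (h₄≡0 ∘ suc)) ⟩
  h 0 (suc n) + antidiagonal₀₂₃ (h ∘ suc) n       ≡⟨ absorb n ⟩
  antidiagonal₀₂₃ h (suc n)                       ∎
  where
  open ≡-Reasoning
  absorb : ∀ n → h 0 (suc n) + antidiagonal₀₂₃ (h ∘ suc) n ≡ antidiagonal₀₂₃ h (suc n)
  absorb 0                                    rewrite h₁≡0 0 = ℤ.+-identityˡ _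
  absorb 1                                    = ℤ.+-comm (h 0 2) (h 2 0)
  absorb 2                                    = ℤ.+-comm (h 0 3) (h 3 0 + h 1 2)
  absorb (suc (suc (suc n))) rewrite h₄≡0 0 n = ℤ.+-identityˡ _

denom-degree≤1 : ∀ k l → denom k (suc (suc l)) ≡ + 0
denom-degree≤1 0 l                         = refl
denom-degree≤1 1 l                         = refl
denom-degree≤1 2 l                         = refl
denom-degree≤1 3 l                         = refl
denom-degree≤1 (suc (suc (suc (suc k)))) l = refl

denom-1 : ∀ l → denom 1 l ≡ + 0
denom-1 zero    = refl
denom-1 (suc l) = refl

denom-≥4 : ∀ k l → denom (suc (suc (suc (suc k)))) l ≡ + 0
denom-≥4 k zero    = refl
denom-≥4 k (suc l) = refl

C′·denom : ℕ → ℕ → ℕ → ℤ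
C′·denom p i k = sumTo p (λ j → + C′ i j * denom k (p ∸ j))

C′·denom≡0 : ∀ p i k → (∀ l → denom k l ≡ + 0) → C′·denom p i k ≡ + 0
C′·denom≡0 p i k denom≡0 = sumTo-zero p λ j →
  trans (cong (+ C′ i j *_) (denom≡0 (p ∸ j))) (ℤ.*-zeroʳ (+ C′ i j))

C′·denom-antidiagonal : ∀ p i k → C′·denom p i k ≡ antidiagonal₀₁ (λ j l → + C′ i j * denom k l) p
C′·denom-antidiagonal p i k = sumTo-antidiagonal₀₁ p _ λ j l →
  trans (cong (+ C′ i j *_) (denom-degree≤1 k l)) (ℤ.*-zeroʳ (+ C′ i j))

C′·denom-0 : ∀ p i → C′·denom p i 0 ≡ + C′ i p
C′·denom-0 p i = trans (C′·denom-antidiagonal p i 0) (constant p)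
  where
  constant : ∀ p → antidiagonal₀₁ (λ j l → + C′ i j * denom 0 l) p ≡ + C′ i p
  constant zero = ℤ.*-identityʳ _
  constant (suc p) rewrite ℤ.*-identityʳ (+ C′ i (suc p)) | ℤ.*-zeroʳ (+ C′ i p) = ℤ.+-identityʳ _

-x·_ : Poly → ℕ → ℤ
(-x· A) zero    = + 0
(-x· A) (suc p) = - + A p

C′·denom≡-x· : ∀ p i k → denom k 0 ≡ + 0 → denom k 1 ≡ - + 1 → C′·denom p i k ≡ (-x· C′ i) p
C′·denom≡-x· p i k d₀ d₁ = trans (C′·denom-antidiagonal p i k) (linear p)
  where
  open +-*-Solver
  linear : ∀ p → antidiagonal₀₁ (λ j l → + C′ i j * denom k l) p ≡ (-x· C′ i) p
  linear zero    rewrite d₀      = ℤ.*-zeroʳ (+ C′ i 0)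
  linear (suc p) rewrite d₀ | d₁ =
    solve 2 (λ a b → a :* con (+ 0) :+ b :* con (- + 1) := :- b) refl (+ C′ i (suc p)) (+ C′ i p)

numer-coefficients : ∀ n p → antidiagonal₀₂₃ (C′·denom p) n ≡ numer n p
numer-coefficients 0 p rewrite C′·denom-0 p 0 with p
... | zero  = refl
... | suc _ = refl
numer-coefficients 1 p rewrite C′·denom-0 p 1 with p
... | zero        = refl
... | suc zero    = refl
... | suc (suc _) = refl
numer-coefficients 2 p rewrite C′·denom-0 p 2 | C′·denom≡-x· p 0 2 refl refl with p
... | zero        = refl
... | suc zero    = refl
... | suc (suc _) = refl
numer-coefficients (suc (suc (suc n))) p
  rewrite C′·denom-0 p (suc (suc (suc n)))
        | C′·denom≡-x· p (suc n) 2 refl refl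
        | C′·denom≡-x· p n 3 refl refl
  with p
... | zero  = refl
-- C′ (3 + n) (1 + q) unfolds to C′ (1 + n) q + C′ n q, which the two −x· terms cancel.
... | suc q = cancel (C′ (suc n) q) (C′ n q)
  where
  open +-*-Solver
  cancel : ∀ a b → + (a ℕ.+ b) + - + a + - + b ≡ + 0
  cancel a b rewrite ℤ.pos-+ a b =
    solve 2 (λ x y → x :+ y :+ :- x :+ :- y := con (+ 0)) refl (+ a) (+ b)

generating-function : (genFun C′ *S denom) ≈S numer
generating-function n p = trans
  (sumTo-antidiagonal₀₂₃ n (C′·denom p)
    (λ i → C′·denom≡0 p i 1 denom-1) (λ i k → C′·denom≡0 p i (4 ℕ.+ k) (denom-≥4 k)))
  (numer-coefficients n p)

corollary1 : Σ (ℕ → Poly) λ C →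
    (∀ n p → HasCount (IsMaximalHypercube n p) (C n p)) ×
    (∀ n → n ≥ 3 → C n ≈P (x· (C (n ∸ 2) +P C (n ∸ 3)))) ×
    (C 0 ≈P constP 1) ×
    (C 1 ≈P linP 1) ×
    (C 2 ≈P linP 2) ×
    ((genFun C *S denom) ≈S numer)
corollary1 = C′ , maximal-hypercubes-count , recurrence ,
             (λ _ → refl) , (λ _ → refl) , (λ _ → refl) , generating-function
  where
  recurrence : ∀ n → n ≥ 3 → C′ n ≈P (x· (C′ (n ∸ 2) +P C′ (n ∸ 3)))
  recurrence (suc (suc (suc n))) (s≤s (s≤s (s≤s _))) _ = refl
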